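{- Let $\mathscr{A}=(Q,\Sigma,\delta)$ be an aperiodically $1$-contracting DFA with state set $Q=\{q_1,\ldots,q_n\}$, and let $W=\{w_1,\ldots,w_n\}$ be a $1$-contracting collection with $w_i$ excluding $q_i$ and with $\sigma_W$ a cyclic permutation of $Q$. Define $\mathscr{S}_{k,i},\mathscr{T}_k,\mathscr{U}_{k,i}$ as in the context. For $1\le k\le n-1$ and $1\le i\le n$ let $\overline{\mathscr{S}}_{k,i}=\{S\subseteq Q\mid q_i^c\in S,\ q_i\notin S,\ |S|=n-k\}$ and $\overline{\mathscr{T}}_k=\{S\subseteq Q\mid |S|=n-k\}$. Then for all such $i$ and $k$, $\mathscr{S}_{k,i}=\overline{\mathscr{S}}_{k,i}$ and $\mathscr{T}_k=\overline{\mathscr{T}}_k$.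
   Context: DFA $\mathscr{A}=(Q,\Sigma,\delta)$, transition function extended to words and to subsets by $\delta(S,w)=\{\delta(q,w)\mid q\in S\}$; $\delta^{ -1}(q,w)=\{p\in Q\mid\delta(p,w)=q\}$. A word $w$ is $1$-deficient excluding $q$ if $\delta(Q,w)=Q\setminus\{q\}$; then exactly one state $q^c$ has $|\delta^{ -1}(q^c,w)|=2$ (its contracting state). A $1$-contracting collection contains, for each $q\in Q$, exactly one $1$-deficient word excluding $q$; its state map $\sigma_W$ sends $q$ to the contracting state of that word. $\mathscr{A}$ is aperiodically $1$-contracting if some such $W$ has $\sigma_W$ a cyclic permutation (single $n$-cycle). Write $q_i^c=\sigma_W(q_i)$, the contracting state of $w_i$. Define $\mathscr{S}_{0,i}=\mathscr{T}_0=\mathscr{U}_{0,i}=\{Q\}$ for all $i$, and recursively for $k=1,\ldots,n-1$: $\mathscr{S}_{k,i}=\{\delta(S,w_i)\mid S\in\mathscr{U}_{k-1,i}\}$, $\mathscr{T}_k=\bigcup_{i=1}^n\mathscr{S}_{k,i}$, $\mathscr{U}_{k,i}=\{S\in\mathscr{T}_k\mid \delta^{ -1}(q_i^c,w_i)\subseteq S\}$. -}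

module Defs where

open import Data.Nat using (ℕ; zero; suc)
open import Data.Fin using (Fin; _≟_)
open import Data.Fin.Properties using (any?)
open import Data.Fin.Subset using (Subset; _∈_; ⊤; _─_; ⁅_⁆; ∣_∣)
open import Data.Fin.Subset.Properties using (_∈?_)
open import Data.Vec using (tabulate)
open import Data.List using (List; []; _∷_)
open import Data.Product using (Σ; ∃; _×_; _,_)
open import Function using (_∘_)
open import Relation.Nullary using (does)
open import Relation.Nullary.Decidable using (_×-dec_)
open import Relation.Binary.PropositionalEquality using (_≡_)

-- A DFA with state set Fin n (q_1..q_n), alphabet an arbitrary type A,
-- transition function δ : Fin n → A → Fin n.

δ* : ∀ {n} {A : Set} → (Fin n → A → Fin n) → Fin n → List A → Fin n
δ* δ p []      = p
δ* δ p (a ∷ w) = δ* δ (δ p a) w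

img : ∀ {n} {A : Set} → (Fin n → A → Fin n) → Subset n → List A → Subset n
img δ S w = tabulate (λ q → does (any? (λ p → (p ∈? S) ×-dec (δ* δ p w ≟ q))))

pre : ∀ {n} {A : Set} → (Fin n → A → Fin n) → Fin n → List A → Subset n
pre δ q w = tabulate (λ p → does (δ* δ p w ≟ q))

Deficient : ∀ {n} {A : Set} → (Fin n → A → Fin n) → List A → Fin n → Set
Deficient δ w q = img δ ⊤ w ≡ ⊤ ─ ⁅ q ⁆

IsContracting : ∀ {n} {A : Set} → (Fin n → A → Fin n) → List A → Fin n → Set
IsContracting δ w q = ∣ pre δ q w ∣ ≡ 2

iter : ∀ {n} → (Fin n → Fin n) → ℕ → Fin n → Fin n
iter σ zero    q = q
iter σ (suc k) q = σ (iter σ k q)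

-- σ is a cyclic permutation of Fin n (a single n-cycle): every state is
-- reached from every other state by iterating σ.
IsCyclicPerm : ∀ {n} → (Fin n → Fin n) → Set
IsCyclicPerm {n} σ = (p q : Fin n) → ∃ λ k → iter σ k p ≡ q

-- The families 𝒮_{k,i}, 𝒯_k, 𝒰_{k,i}, as predicates on subsets of Q,
-- for the collection w (w i excludes i) with contracting states c i.
module Families {n : ℕ} {A : Set} (δ : Fin n → A → Fin n)
                (w : Fin n → List A) (c : Fin n → Fin n) where

  mutual
    𝒮 : ℕ → Fin n → Subset n → Set
    𝒮 zero    i X = X ≡ ⊤
    𝒮 (suc k) i X = Σ (Subset n) λ Y → 𝒰 k i Y × X ≡ img δ Y (w i)

    𝒯 : ℕ → Subset n → Set
    𝒯 zero    X = X ≡ ⊤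
    𝒯 (suc k) X = Σ (Fin n) λ i → 𝒮 (suc k) i X

    𝒰 : ℕ → Fin n → Subset n → Set
    𝒰 zero    i X = X ≡ ⊤
    𝒰 (suc k) i X = 𝒯 (suc k) X × (∀ p → p ∈ pre δ (c i) (w i) → p ∈ X)

module Submission where

-- Fix i and let f = δ(·, w_i) : Q → Q.  Since w_i is 1-deficient
-- excluding i with contracting state c = c_i, the fibre of f over i is empty,
-- the fibre over c has two elements and every other fibre is non-empty; as the
-- fibre sizes add up to n, every other fibre is a singleton.  Hence f is
-- injective outside f⁻¹(c), |f⁻¹(X)| = |X| + 1 whenever c ∈ X and i ∉ X, and
-- one step S ↦ δ(S, w_i) of the recursion is a bijection between
--   {Y | |Y| = m, f⁻¹(c) ⊆ Y}   and   {X | |X| = m - 1, c ∈ X, i ∉ X}.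
-- So if 𝒯_k consists of all sets of size n - k, then 𝒰_{k,i} is the left-hand
-- family with m = n - k and 𝒮_{k+1,i} the right-hand one.  Conversely every X
-- with 0 < |X| < n lies in some 𝒮_{k+1,i}: walking along the n-cycle σ_W from a
-- state outside X to a state inside X, some step i ↦ c_i enters X.

open import Defs
open import Data.Nat using (ℕ; zero; suc; _+_; _*_; _∸_; _≤_; _<_; z≤n; s≤s)
open import Data.Nat.Properties
  using (+-*-semiring; ≤-trans; ≤-antisym; ≤-reflexive; <-irrefl; +-comm;
         +-identityʳ; *-comm; +-mono-≤; +-monoʳ-≤; +-cancelʳ-≤; m≤m+n;
         +-∸-assoc; m<n⇒0<n∸m; ∸-monoʳ-<; n≤1+n; suc-injective)
open import Data.Bool using (Bool; true; false; not)
open import Data.Fin as Fin using (Fin; _≟_; punchIn; punchOut)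
open import Data.Fin.Properties using (any?; punchInᵢ≢i; punchIn-punchOut)
open import Data.Fin.Subset using (Subset; _∈_; _∉_; _⊆_; ∣_∣; ⊤; ∁; _─_; ⁅_⁆; inside; outside)
open import Data.Fin.Subset.Properties
  using (_∈?_; ∈⊤; ⊆⊤; ⊆-antisym; ∣⊤∣≡n; ∣⊥∣≡0; ∣p∣≡n⇒p≡⊤; nonempty?; Empty-unique;
         x∉∁p⇒x∈p; x∈∁p⇒x∉p; x∈p∧x∉q⇒x∈p─q; x≢y⇒x∉⁅y⁆; x∈⁅x⁆)
open import Data.Vec using ([]; _∷_; lookup; tabulate)
open import Data.Vec.Properties using (lookup∘tabulate; []=⇒lookup; lookup⇒[]=)
open import Data.Vec.Base using (here; there)
open import Data.List using (List)
open import Data.Product using (∃; _×_; _,_; proj₁; proj₂)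
open import Data.Empty using (⊥-elim)
open import Function using (_∘_)
open import Function.Bundles using (_⇔_; mk⇔; Equivalence)
open import Relation.Nullary using (Dec; yes; no; does; ¬_)
open import Relation.Nullary.Decidable using (dec-true; dec-false; _×-dec_)
open import Relation.Binary.PropositionalEquality
  using (_≡_; _≢_; refl; sym; trans; cong; cong₂; subst; module ≡-Reasoning)

open import Algebra.Properties.Semiring.Sum +-*-semiring
  using (sum; sum-syntax; sum-cong-≗; sum-remove; ∑-distrib-+; ∑-comm; *-distribʳ-sum)

𝟙 : Bool → ℕ
𝟙 true  = 1
𝟙 false = 0

𝟙-holds : ∀ {P : Set} (d : Dec P) → P → 𝟙 (does d) ≡ 1
𝟙-holds d p = cong 𝟙 (dec-true d p)

𝟙-fails : ∀ {P : Set} (d : Dec P) → ¬ P → 𝟙 (does d) ≡ 0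
𝟙-fails d ¬p = cong 𝟙 (dec-false d ¬p)

𝟙-not+𝟙 : ∀ b → 𝟙 (not b) + 𝟙 b ≡ 1
𝟙-not+𝟙 true  = refl
𝟙-not+𝟙 false = refl

does-true : ∀ {P : Set} (d : Dec P) → does d ≡ true → P
does-true (yes p) _  = p
does-true (no _)  ()

∑-const-1 : ∀ n → ∑[ q < n ] 1 ≡ n
∑-const-1 zero    = refl
∑-const-1 (suc n) = cong suc (∑-const-1 n)

∑-zero : ∀ n → ∑[ q < n ] 0 ≡ 0
∑-zero zero    = refl
∑-zero (suc n) = ∑-zero n

∑-point : ∀ {n} (t : Fin n → ℕ) x → (∀ q → q ≢ x → t q ≡ 0) → sum t ≡ t x
∑-point {suc n} t x vanish = begin
  sum t                    ≡⟨ sum-remove {i = x} t ⟩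
  t x + sum (t ∘ punchIn x) ≡⟨ cong (t x +_) (sum-cong-≗ (λ j → vanish _ (punchInᵢ≢i x j))) ⟩
  t x + ∑[ j < n ] 0       ≡⟨ cong (t x +_) (∑-zero n) ⟩
  t x + 0                  ≡⟨ +-identityʳ (t x) ⟩
  t x                      ∎
  where open ≡-Reasoning

∑-𝟙-≟ : ∀ {n} (x : Fin n) → ∑[ q < n ] 𝟙 (does (q ≟ x)) ≡ 1
∑-𝟙-≟ x = trans (∑-point _ x (λ q q≢x → 𝟙-fails (q ≟ x) q≢x)) (𝟙-holds (x ≟ x) refl)

∑-mono : ∀ {n} {g h : Fin n → ℕ} → (∀ q → g q ≤ h q) → sum g ≤ sum h
∑-mono {zero}  g≤h = z≤n
∑-mono {suc n} g≤h = +-mono-≤ (g≤h Fin.zero) (∑-mono (g≤h ∘ Fin.suc))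

term≤∑ : ∀ {n} (t : Fin n → ℕ) x → t x ≤ sum t
term≤∑ {suc n} t x = ≤-trans (m≤m+n (t x) _) (≤-reflexive (sym (sum-remove {i = x} t)))

two-terms≤∑ : ∀ {n} (t : Fin n → ℕ) x y → x ≢ y → t x + t y ≤ sum t
two-terms≤∑ {suc n} t x y x≢y = begin
  t x + t y                               ≡⟨ cong (λ z → t x + t z) (sym (punchIn-punchOut x≢y)) ⟩
  t x + t (punchIn x (punchOut x≢y))      ≤⟨ +-monoʳ-≤ (t x) (term≤∑ (t ∘ punchIn x) (punchOut x≢y)) ⟩
  t x + sum (t ∘ punchIn x)               ≡⟨ sum-remove {i = x} t ⟨
  sum t                                   ∎
  where open Data.Nat.Properties.≤-Reasoning

∑-tight : ∀ {n} {g h : Fin n → ℕ} → (∀ q → g q ≤ h q) → sum h ≤ sum g → ∀ x → g x ≡ h x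
∑-tight {suc n} {g} {h} g≤h ∑h≤∑g x = ≤-antisym (g≤h x) (+-cancelʳ-≤ _ (h x) (g x) (begin
  h x + sum (h ∘ punchIn x)  ≡⟨ sum-remove {i = x} h ⟨
  sum h                      ≤⟨ ∑h≤∑g ⟩
  sum g                      ≡⟨ sum-remove {i = x} g ⟩
  g x + sum (g ∘ punchIn x)  ≤⟨ +-monoʳ-≤ (g x) (∑-mono (g≤h ∘ punchIn x)) ⟩
  g x + sum (h ∘ punchIn x)  ∎))
  where open Data.Nat.Properties.≤-Reasoning

∈⇔lookup : ∀ {n} {X : Subset n} {q} → q ∈ X ⇔ lookup X q ≡ true
∈⇔lookup {X = X} {q} = mk⇔ []=⇒lookup (lookup⇒[]= q X)

∈-tabulate : ∀ {n} (b : Fin n → Bool) {q} → q ∈ tabulate b ⇔ b q ≡ true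
∈-tabulate b {q} = mk⇔ (λ m → trans (sym (lookup∘tabulate b q)) (Equivalence.to ∈⇔lookup m))
                       (λ e → Equivalence.from ∈⇔lookup (trans (lookup∘tabulate b q) e))

∈-decided : ∀ {n} {P : Fin n → Set} (P? : ∀ q → Dec (P q)) {q} →
            q ∈ tabulate (λ q → does (P? q)) ⇔ P q
∈-decided P? {q} = mk⇔ (does-true (P? q) ∘ Equivalence.to (∈-tabulate _))
                       (Equivalence.from (∈-tabulate _) ∘ dec-true (P? q))

∣∣≡∑ : ∀ {n} (X : Subset n) → ∣ X ∣ ≡ ∑[ q < n ] 𝟙 (lookup X q)
∣∣≡∑ []            = refl
∣∣≡∑ (inside ∷ X)  = cong suc (∣∣≡∑ X)
∣∣≡∑ (outside ∷ X) = ∣∣≡∑ X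

x∈p─q⇒x∉q : ∀ {n} {x : Fin n} {p q : Subset n} → x ∈ p ─ q → x ∉ q
x∈p─q⇒x∉q {p = inside ∷ p} {outside ∷ q} here ()
x∈p─q⇒x∉q {p = _ ∷ p} {_ ∷ q} (there x∈p─q) (there x∈q) = x∈p─q⇒x∉q x∈p─q x∈q

∈Q─⁅i⁆⇔≢ : ∀ {n} {i q : Fin n} → q ∈ ⊤ ─ ⁅ i ⁆ ⇔ q ≢ i
∈Q─⁅i⁆⇔≢ {i = i} = mk⇔ (λ m q≡i → x∈p─q⇒x∉q m (subst (_∈ ⁅ i ⁆) (sym q≡i) (x∈⁅x⁆ i)))
                      (λ q≢i → x∈p∧x∉q⇒x∈p─q ∈⊤ (x≢y⇒x∉⁅y⁆ q≢i))

member-of-nonempty : ∀ {n} (X : Subset n) → 0 < ∣ X ∣ → ∃ λ a → a ∈ X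
member-of-nonempty {n} X 0<∣X∣ with nonempty? X
... | yes a∈X = a∈X
... | no empty = ⊥-elim (<-irrefl (sym ∣X∣≡0) 0<∣X∣)
  where
  ∣X∣≡0 : ∣ X ∣ ≡ 0
  ∣X∣≡0 = trans (cong ∣_∣ (Empty-unique empty)) (∣⊥∣≡0 n)

nonmember-of-proper : ∀ {n} (X : Subset n) → ∣ X ∣ < n → ∃ λ b → b ∉ X
nonmember-of-proper {n} X ∣X∣<n with nonempty? (∁ X)
... | yes (b , b∈∁X) = b , x∈∁p⇒x∉p b∈∁X
... | no empty = ⊥-elim (<-irrefl ∣X∣≡n ∣X∣<n)
  where
  X≡Q : X ≡ ⊤
  X≡Q = ⊆-antisym ⊆⊤ (λ {q} _ → x∉∁p⇒x∈p (λ q∈∁X → empty (q , q∈∁X)))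
  ∣X∣≡n : ∣ X ∣ ≡ n
  ∣X∣≡n = trans (cong ∣_∣ X≡Q) (∣⊤∣≡n n)

fibre : ∀ {n m} → (Fin n → Fin m) → Fin m → ℕ
fibre {n} f q = ∑[ p < n ] 𝟙 (does (f p ≟ q))

∑-∘-fibre : ∀ {n m} (f : Fin n → Fin m) (h : Fin m → ℕ) →
            ∑[ p < n ] h (f p) ≡ ∑[ q < m ] (h q * fibre f q)
∑-∘-fibre {n} {m} f h = begin
  ∑[ p < n ] h (f p)                               ≡⟨ sum-cong-≗ (sym ∘ pick) ⟩
  ∑[ p < n ] ∑[ q < m ] (𝟙 (does (f p ≟ q)) * h q)  ≡⟨ ∑-comm {n} {m} (λ p q → 𝟙 (does (f p ≟ q)) * h q) ⟩
  ∑[ q < m ] ∑[ p < n ] (𝟙 (does (f p ≟ q)) * h q)  ≡⟨ sum-cong-≗ (λ q → sym (*-distribʳ-sum {n} (h q) _)) ⟩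
  ∑[ q < m ] (fibre f q * h q)                     ≡⟨ sum-cong-≗ (λ q → *-comm (fibre f q) (h q)) ⟩
  ∑[ q < m ] (h q * fibre f q)                     ∎
  where
  open ≡-Reasoning
  pick : ∀ p → ∑[ q < m ] (𝟙 (does (f p ≟ q)) * h q) ≡ h (f p)
  pick p = trans (∑-point _ (f p) (λ q q≢fp → cong (_* h q) (𝟙-fails (f p ≟ q) (q≢fp ∘ sym))))
                 (trans (cong (_* h (f p)) (𝟙-holds (f p ≟ f p) refl)) (+-identityʳ (h (f p))))

∑-fibre : ∀ {n m} (f : Fin n → Fin m) → ∑[ q < m ] fibre f q ≡ n
∑-fibre {n} {m} f = begin
  ∑[ q < m ] fibre f q        ≡⟨ sum-cong-≗ (λ q → sym (+-identityʳ (fibre f q))) ⟩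
  ∑[ q < m ] (1 * fibre f q)  ≡⟨ ∑-∘-fibre f (λ _ → 1) ⟨
  ∑[ p < n ] 1                ≡⟨ ∑-const-1 n ⟩
  n                           ∎
  where open ≡-Reasoning

preimage : ∀ {n m} → (Fin n → Fin m) → Subset m → Subset n
preimage f X = tabulate (λ p → lookup X (f p))

∈-preimage : ∀ {n m} (f : Fin n → Fin m) {X : Subset m} {p} → p ∈ preimage f X ⇔ f p ∈ X
∈-preimage f {X} = mk⇔ (Equivalence.from ∈⇔lookup ∘ Equivalence.to (∈-tabulate (lookup X ∘ f)))
                       (Equivalence.from (∈-tabulate (lookup X ∘ f)) ∘ Equivalence.to ∈⇔lookup)

∣preimage∣ : ∀ {n m} (f : Fin n → Fin m) (X : Subset m) →
             ∣ preimage f X ∣ ≡ ∑[ q < m ] (𝟙 (lookup X q) * fibre f q)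
∣preimage∣ {n} {m} f X = begin
  ∣ preimage f X ∣                       ≡⟨ ∣∣≡∑ (preimage f X) ⟩
  ∑[ p < n ] 𝟙 (lookup (preimage f X) p) ≡⟨ sum-cong-≗ (λ p → cong 𝟙 (lookup∘tabulate (lookup X ∘ f) p)) ⟩
  ∑[ p < n ] 𝟙 (lookup X (f p))          ≡⟨ ∑-∘-fibre f (𝟙 ∘ lookup X) ⟩
  ∑[ q < m ] (𝟙 (lookup X q) * fibre f q) ∎
  where open ≡-Reasoning

-- A self-map f of Q that misses exactly the state i and sends exactly two
-- states to c; this is the shape of δ(·, w) for a word w that is 1-deficient
-- excluding i with contracting state c.
module OneDeficientMap {n} (f : Fin n → Fin n) (i c : Fin n)
  (misses  : ∀ p → f p ≢ i)
  (covers  : ∀ q → q ≢ i → ∃ λ p → f p ≡ q)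
  (doubles : fibre f c ≡ 2) where

  -- The fibre over i is empty while the one over c is not.
  c≢i : c ≢ i
  c≢i c≡i = 0≢2 (trans (sym fibre-i) (subst (λ q → fibre f q ≡ 2) c≡i doubles))
    where
    fibre-i : fibre f i ≡ 0
    fibre-i = trans (sum-cong-≗ (λ p → 𝟙-fails (f p ≟ i) (misses p))) (∑-zero n)
    0≢2 : 0 ≢ 2
    0≢2 ()

  -- The fibre sizes forced by the hypotheses: 0 over i, 2 over c, 1 elsewhere.
  expected : Fin n → ℕ
  expected q = 𝟙 (not (does (q ≟ i))) + 𝟙 (does (q ≟ c))

  expected≤fibre : ∀ q → expected q ≤ fibre f q
  expected≤fibre q with q ≟ i | q ≟ c
  ... | yes q≡i | yes q≡c = ⊥-elim (c≢i (trans (sym q≡c) q≡i))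
  ... | yes _   | no _    = z≤n
  ... | no _    | yes refl = ≤-reflexive (sym doubles)
  ... | no q≢i  | no _ with covers q q≢i
  ...   | p , fp≡q = ≤-trans (≤-reflexive (sym (𝟙-holds (f p ≟ q) fp≡q))) (term≤∑ _ p)

  ∑-expected : ∑[ q < n ] expected q ≡ n
  ∑-expected = begin
    ∑[ q < n ] expected q                                 ≡⟨ ∑-distrib-+ (𝟙 ∘ not ∘ is i) (𝟙 ∘ is c) ⟩
    ∑[ q < n ] 𝟙 (not (is i q)) + ∑[ q < n ] 𝟙 (is c q)   ≡⟨ cong (∑[ q < n ] 𝟙 (not (is i q)) +_) (trans (∑-𝟙-≟ c) (sym (∑-𝟙-≟ i))) ⟩
    ∑[ q < n ] 𝟙 (not (is i q)) + ∑[ q < n ] 𝟙 (is i q)   ≡⟨ ∑-distrib-+ (𝟙 ∘ not ∘ is i) (𝟙 ∘ is i) ⟨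
    ∑[ q < n ] (𝟙 (not (is i q)) + 𝟙 (is i q))           ≡⟨ sum-cong-≗ (𝟙-not+𝟙 ∘ is i) ⟩
    ∑[ q < n ] 1                                          ≡⟨ ∑-const-1 n ⟩
    n                                                     ∎
    where
    open ≡-Reasoning
    is : Fin n → Fin n → Bool
    is x q = does (q ≟ x)

  fibre-exact : ∀ q → fibre f q ≡ expected q
  fibre-exact q = sym (∑-tight expected≤fibre (≤-reflexive (trans (∑-fibre f) (sym ∑-expected))) q)

  injective-off-c : ∀ {p s} → f p ≡ f s → f p ≢ c → p ≡ s
  injective-off-c {p} {s} fp≡fs fp≢c with p ≟ s
  ... | yes p≡s = p≡s
  ... | no p≢s = ⊥-elim (2≰1 (begin
    2                                                   ≡⟨ cong₂ _+_ (𝟙-holds (f p ≟ f p) refl) (𝟙-holds (f s ≟ f p) (sym fp≡fs)) ⟨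
    𝟙 (does (f p ≟ f p)) + 𝟙 (does (f s ≟ f p))         ≤⟨ two-terms≤∑ (λ r → 𝟙 (does (f r ≟ f p))) p s p≢s ⟩
    fibre f (f p)                                       ≡⟨ fibre-exact (f p) ⟩
    𝟙 (not (does (f p ≟ i))) + 𝟙 (does (f p ≟ c))       ≡⟨ cong₂ _+_ (cong (𝟙 ∘ not) (dec-false (f p ≟ i) (misses p))) (𝟙-fails (f p ≟ c) fp≢c) ⟩
    1                                                   ∎))
    where
    open Data.Nat.Properties.≤-Reasoning
    2≰1 : ¬ 2 ≤ 1
    2≰1 (s≤s ())

  ∣preimage∣≡suc : ∀ X → c ∈ X → i ∉ X → ∣ preimage f X ∣ ≡ suc ∣ X ∣
  ∣preimage∣≡suc X c∈X i∉X = begin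
    ∣ preimage f X ∣                                    ≡⟨ ∣preimage∣ f X ⟩
    ∑[ q < n ] (𝟙 (lookup X q) * fibre f q)             ≡⟨ sum-cong-≗ (λ q → cong (𝟙 (lookup X q) *_) (fibre-exact q)) ⟩
    ∑[ q < n ] (𝟙 (lookup X q) * expected q)            ≡⟨ sum-cong-≗ weight ⟩
    ∑[ q < n ] (𝟙 (lookup X q) + 𝟙 (does (q ≟ c)))      ≡⟨ ∑-distrib-+ (𝟙 ∘ lookup X) (λ q → 𝟙 (does (q ≟ c))) ⟩
    ∑[ q < n ] 𝟙 (lookup X q) + ∑[ q < n ] 𝟙 (does (q ≟ c)) ≡⟨ cong₂ _+_ (sym (∣∣≡∑ X)) (∑-𝟙-≟ c) ⟩
    ∣ X ∣ + 1                                           ≡⟨ +-comm ∣ X ∣ 1 ⟩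
    suc ∣ X ∣                                           ∎
    where
    open ≡-Reasoning
    -- Inside X the expected size is 1 plus the extra state over c; i is outside X.
    weight : ∀ q → 𝟙 (lookup X q) * expected q ≡ 𝟙 (lookup X q) + 𝟙 (does (q ≟ c))
    weight q with lookup X q in X[q] | q ≟ i | q ≟ c
    ... | true  | yes refl | _        = ⊥-elim (i∉X (Equivalence.from ∈⇔lookup X[q]))
    ... | true  | no _     | yes _    = refl
    ... | true  | no _     | no _     = refl
    ... | false | _        | yes refl = ⊥-elim (true≢false (trans (sym (Equivalence.to ∈⇔lookup c∈X)) X[q]))
      where
      true≢false : true ≢ false
      true≢false ()
    ... | false | _        | no _     = refl

step-into : ∀ {n} (c : Fin n → Fin n) (X : Subset n) k b →
            b ∉ X → iter c k b ∈ X → ∃ λ i → c i ∈ X × i ∉ X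
step-into c X zero    b b∉X b∈X = ⊥-elim (b∉X b∈X)
step-into c X (suc k) b b∉X cᵏ⁺¹b∈X with iter c k b ∈? X
... | yes cᵏb∈X = step-into c X k b b∉X cᵏb∈X
... | no  cᵏb∉X = iter c k b , cᵏ⁺¹b∈X , cᵏb∉X

cyclic-enters : ∀ {n} {c : Fin n → Fin n} → IsCyclicPerm c →
                ∀ (X : Subset n) {a b} → a ∈ X → b ∉ X → ∃ λ i → c i ∈ X × i ∉ X
cyclic-enters {c = c} cyclic X {a} {b} a∈X b∉X with cyclic b a
... | k , cᵏb≡a = step-into c X k b b∉X (subst (_∈ X) (sym cᵏb≡a) a∈X)

∈-img : ∀ {n} {A : Set} (δ : Fin n → A → Fin n) (Y : Subset n) (v : List A) {q} →
        q ∈ img δ Y v ⇔ ∃ λ p → p ∈ Y × δ* δ p v ≡ q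
∈-img δ Y v = ∈-decided (λ q → any? (λ p → (p ∈? Y) ×-dec (δ* δ p v ≟ q)))

∈-pre : ∀ {n} {A : Set} (δ : Fin n → A → Fin n) (q : Fin n) (v : List A) {p} →
        p ∈ pre δ q v ⇔ δ* δ p v ≡ q
∈-pre δ q v = ∈-decided (λ p → δ* δ p v ≟ q)

∣pre∣≡fibre : ∀ {n} {A : Set} (δ : Fin n → A → Fin n) (q : Fin n) (v : List A) →
              ∣ pre δ q v ∣ ≡ fibre (λ p → δ* δ p v) q
∣pre∣≡fibre δ q v = trans (∣∣≡∑ (pre δ q v))
                          (sum-cong-≗ (cong 𝟙 ∘ lookup∘tabulate (λ p → does (δ* δ p v ≟ q))))

∸-peel : ∀ n k → k < n → n ∸ k ≡ suc (n ∸ suc k)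
∸-peel n k k<n = +-∸-assoc 1 k<n

module Recursion {n} {A : Set} (δ : Fin n → A → Fin n)
  (w : Fin n → List A) (c : Fin n → Fin n)
  (deficient   : ∀ i → Deficient δ (w i) i)
  (contracting : ∀ i → IsContracting δ (w i) (c i))
  (cyclic      : IsCyclicPerm c) where

  open Families δ w c

  act : Fin n → Fin n → Fin n
  act i p = δ* δ p (w i)

  misses : ∀ i p → act i p ≢ i
  misses i p fp≡i = Equivalence.to ∈Q─⁅i⁆⇔≢ i∈Q─⁅i⁆ refl
    where
    i∈Q─⁅i⁆ : i ∈ ⊤ ─ ⁅ i ⁆
    i∈Q─⁅i⁆ = subst (i ∈_) (deficient i) (Equivalence.from (∈-img δ ⊤ (w i)) (p , ∈⊤ , fp≡i))

  covers : ∀ i q → q ≢ i → ∃ λ p → act i p ≡ q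
  covers i q q≢i with Equivalence.to (∈-img δ ⊤ (w i))
                        (subst (q ∈_) (sym (deficient i)) (Equivalence.from ∈Q─⁅i⁆⇔≢ q≢i))
  ... | p , _ , fp≡q = p , fp≡q

  doubles : ∀ i → fibre (act i) (c i) ≡ 2
  doubles i = trans (sym (∣pre∣≡fibre δ (c i) (w i))) (contracting i)

  module Act (i : Fin n) = OneDeficientMap (act i) i (c i) (misses i) (covers i) (doubles i)
  open Act using (c≢i; injective-off-c; ∣preimage∣≡suc)

  ContainsPair : Fin n → Subset n → Set
  ContainsPair i Y = ∀ p → p ∈ pre δ (c i) (w i) → p ∈ Y

  image-shape : ∀ i Y → ContainsPair i Y → c i ∈ img δ Y (w i) × i ∉ img δ Y (w i)
  image-shape i Y pair = c∈ , i∉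
    where
    c∈ : c i ∈ img δ Y (w i)
    c∈ with covers i (c i) (c≢i i)
    ... | p , fp≡c = Equivalence.from (∈-img δ Y (w i))
                       (p , pair p (Equivalence.from (∈-pre δ (c i) (w i)) fp≡c) , fp≡c)
    i∉ : i ∉ img δ Y (w i)
    i∉ i∈ with Equivalence.to (∈-img δ Y (w i)) i∈
    ... | p , _ , fp≡i = misses i p fp≡i

  preimage-image : ∀ i Y → ContainsPair i Y → preimage (act i) (img δ Y (w i)) ≡ Y
  preimage-image i Y pair = ⊆-antisym ⊆Y Y⊆
    where
    ⊆Y : preimage (act i) (img δ Y (w i)) ⊆ Y
    ⊆Y {p} p∈ with Equivalence.to (∈-img δ Y (w i)) (Equivalence.to (∈-preimage (act i)) p∈)
    ... | s , s∈Y , fs≡fp with act i p ≟ c i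
    ...   | yes fp≡c = pair p (Equivalence.from (∈-pre δ (c i) (w i)) fp≡c)
    ...   | no  fp≢c = subst (_∈ Y) (sym (injective-off-c i (sym fs≡fp) fp≢c)) s∈Y
    Y⊆ : Y ⊆ preimage (act i) (img δ Y (w i))
    Y⊆ {p} p∈Y = Equivalence.from (∈-preimage (act i))
                   (Equivalence.from (∈-img δ Y (w i)) (p , p∈Y , refl))

  image-preimage : ∀ i X → i ∉ X → img δ (preimage (act i) X) (w i) ≡ X
  image-preimage i X i∉X = ⊆-antisym ⊆X X⊆
    where
    ⊆X : img δ (preimage (act i) X) (w i) ⊆ X
    ⊆X q∈ with Equivalence.to (∈-img δ _ (w i)) q∈
    ... | p , p∈ , fp≡q = subst (_∈ X) fp≡q (Equivalence.to (∈-preimage (act i)) p∈)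
    X⊆ : X ⊆ img δ (preimage (act i) X) (w i)
    X⊆ {q} q∈X with covers i q (λ q≡i → i∉X (subst (_∈ X) q≡i q∈X))
    ... | p , fp≡q = Equivalence.from (∈-img δ _ (w i))
                       (p , Equivalence.from (∈-preimage (act i)) (subst (_∈ X) (sym fp≡q) q∈X) , fp≡q)

  preimage-contains-pair : ∀ i X → c i ∈ X → ContainsPair i (preimage (act i) X)
  preimage-contains-pair i X c∈X p p∈pair =
    Equivalence.from (∈-preimage (act i))
      (subst (_∈ X) (sym (Equivalence.to (∈-pre δ (c i) (w i)) p∈pair)) c∈X)

  image-size : ∀ i Y → ContainsPair i Y → ∣ Y ∣ ≡ suc ∣ img δ Y (w i) ∣
  image-size i Y pair = begin
    ∣ Y ∣                                     ≡⟨ cong ∣_∣ (preimage-image i Y pair) ⟨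
    ∣ preimage (act i) (img δ Y (w i)) ∣      ≡⟨ ∣preimage∣≡suc i _ c∈ i∉ ⟩
    suc ∣ img δ Y (w i) ∣                     ∎
    where
    open ≡-Reasoning
    c∈ : c i ∈ img δ Y (w i)
    c∈ = proj₁ (image-shape i Y pair)
    i∉ : i ∉ img δ Y (w i)
    i∉ = proj₂ (image-shape i Y pair)

  𝒯-Char : ℕ → Set
  𝒯-Char k = ∀ X → 𝒯 k X ⇔ ∣ X ∣ ≡ n ∸ k

  𝒰-char : ∀ k → 𝒯-Char k → ∀ i Y → 𝒰 k i Y ⇔ (∣ Y ∣ ≡ n ∸ k × ContainsPair i Y)
  𝒰-char zero    _ i Y = mk⇔ (λ { refl → ∣⊤∣≡n n , λ _ _ → ∈⊤ }) (∣p∣≡n⇒p≡⊤ ∘ proj₁)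
  𝒰-char (suc k) 𝒯ₖ i Y = mk⇔ (λ (t , pair) → Equivalence.to (𝒯ₖ Y) t , pair)
                              (λ (size , pair) → Equivalence.from (𝒯ₖ Y) size , pair)

  𝒮-char : ∀ k → suc k < n → 𝒯-Char k → ∀ i X →
           𝒮 (suc k) i X ⇔ (c i ∈ X × i ∉ X × ∣ X ∣ ≡ n ∸ suc k)
  𝒮-char k k+1<n 𝒯ₖ i X = mk⇔ to from
    where
    peel : n ∸ k ≡ suc (n ∸ suc k)
    peel = ∸-peel n k (≤-trans (n≤1+n (suc k)) k+1<n)
    to : 𝒮 (suc k) i X → c i ∈ X × i ∉ X × ∣ X ∣ ≡ n ∸ suc k
    to (Y , u , refl) with Equivalence.to (𝒰-char k 𝒯ₖ i Y) u
    ... | size , pair = proj₁ (image-shape i Y pair) , proj₂ (image-shape i Y pair) ,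
                        suc-injective (trans (sym (image-size i Y pair)) (trans size peel))
    from : c i ∈ X × i ∉ X × ∣ X ∣ ≡ n ∸ suc k → 𝒮 (suc k) i X
    from (c∈X , i∉X , size) =
      preimage (act i) X ,
      Equivalence.from (𝒰-char k 𝒯ₖ i _)
        (trans (∣preimage∣≡suc i X c∈X i∉X) (trans (cong suc size) (sym peel)) ,
         preimage-contains-pair i X c∈X) ,
      sym (image-preimage i X i∉X)

  -- Induction on k, using that each X of size n - (k+1) lies in some 𝒮_{k+1,i}.
  𝒯-char : ∀ k → k < n → 𝒯-Char k
  𝒯-char zero    _ X = mk⇔ (λ { refl → ∣⊤∣≡n n }) ∣p∣≡n⇒p≡⊤
  𝒯-char (suc k) k+1<n X = mk⇔ to from
    where
    k<n : k < n
    k<n = ≤-trans (n≤1+n (suc k)) k+1<n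
    𝒮ₖ₊₁ : ∀ i → 𝒮 (suc k) i X ⇔ (c i ∈ X × i ∉ X × ∣ X ∣ ≡ n ∸ suc k)
    𝒮ₖ₊₁ i = 𝒮-char k k+1<n (𝒯-char k k<n) i X
    to : 𝒯 (suc k) X → ∣ X ∣ ≡ n ∸ suc k
    to (i , s) = proj₂ (proj₂ (Equivalence.to (𝒮ₖ₊₁ i) s))
    -- X is neither empty nor Q, so some step i ↦ c_i of the cycle enters X.
    from : ∣ X ∣ ≡ n ∸ suc k → 𝒯 (suc k) X
    from size with member-of-nonempty X (subst (0 <_) (sym size) (m<n⇒0<n∸m k+1<n))
                 | nonmember-of-proper X (subst (_< n) (sym size) (∸-monoʳ-< (s≤s z≤n) k<n))
    ... | a , a∈X | b , b∉X with cyclic-enters cyclic X a∈X b∉X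
    ...   | i , c∈X , i∉X = i , Equivalence.from (𝒮ₖ₊₁ i) (c∈X , i∉X , size)

proposition1 : {n : ℕ} {A : Set} (δ : Fin n → A → Fin n)
    (w : Fin n → List A) (c : Fin n → Fin n) →
    (∀ i → Deficient δ (w i) i) →
    (∀ i → IsContracting δ (w i) (c i)) →
    IsCyclicPerm c →
    (k : ℕ) → 1 ≤ k → k < n → (i : Fin n) → (X : Subset n) →
    (Families.𝒮 δ w c k i X ⇔ (c i ∈ X × i ∉ X × ∣ X ∣ ≡ n ∸ k))
    × (Families.𝒯 δ w c k X ⇔ ∣ X ∣ ≡ n ∸ k)
proposition1 δ w c deficient contracting cyclic zero () k<n i X
proposition1 δ w c deficient contracting cyclic (suc k) _ k+1<n i X =
  𝒮-char k k+1<n (𝒯-char k (≤-trans (n≤1+n (suc k)) k+1<n)) i X , 𝒯-char (suc k) k+1<n X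
  where open Recursion δ w c deficient contracting cyclic
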